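{- Fix integers $d\ge 3$ and $n\ge 3$. For $m\ge 2$ let $\bar T_m$ be the wired $d$-regular tree of height $m$ with root $r$ (defined in the context), and let $R(\bar T_m)$ be the cyclic subgroup of $SP(\bar T_m)$ generated by $\hat r$. Then \[ SP(\bar T_n) \simeq R(\bar T_n) \oplus \frac{SP(\bar T_{n-1})^{\oplus (d-1)}}{D_{n-1}}, \] where $D_{n-1}$ is the diagonal copy of $R(\bar T_{n-1})$ in $SP(\bar T_{n-1})^{\oplus(d-1)}$, i.e. the cyclic subgroup generated by $(\hat r,\dots,\hat r)$.
   Context: $T_m$ is the finite rooted tree in which every non-leaf vertex has $d-1$ children and every leaf is at distance $m-1$ from the root; $\bar T_m$ is obtained by identifying all leaves to one sink $s$ (keeping parallel edges) and adding one edge from the root $r$ to $s$. Chip configurations are functions from non-sink vertices to $\mathbb{Z}_{\ge0}$; a vertex with at least its degree in chips may topple, sending one chip along each incident edge (chips to $s$ vanish); $u^\circ$ is the unique stable configuration obtained by toppling until stable. A stable $u$ is recurrent if $(u+v)^\circ=u$ for some nonzero $v$. The sandpile group $SP(\bar T_m)$ ($=\mathbb{Z}^{V}/\Delta\mathbb{Z}^{V}$ for the reduced Laplacian $\Delta$) is identified with the set of recurrent configurations under $(u,v)\mapsto(u+v)^\circ$, with identity $e$; $\hat r=(e+\delta_r)^\circ$ where $\delta_r$ is one chip at $r$. -}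

module Defs where

open import Level using (0ℓ)
open import Data.Nat using (ℕ; zero; suc; _∸_)
open import Data.Integer using (ℤ; +_; _+_; _-_; _*_; -_)
open import Data.Fin using (Fin)
open import Data.Product using (∃; Σ; _×_; _,_)
open import Relation.Binary.PropositionalEquality using (_≡_)
open import Algebra.Bundles.Raw using (RawGroup)
open import Algebra.Morphism.Structures using (module GroupMorphisms)

sumFin : (n : ℕ) → (Fin n → ℤ) → ℤ
sumFin zero    f = + 0
sumFin (suc n) f = f Fin.zero + sumFin n (λ i → f (Fin.suc i))

module _ (d : ℕ) where

  b : ℕ
  b = d ∸ 1

  -- Non-leaf vertices of the d-regular rooted tree in which leaves sit at
  -- distance k from the root:  Vtx 0 is empty,  Vtx (suc k) = root plus
  -- (d-1) copies of Vtx k hanging below the root.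
  -- For the wired tree  T̄_m  the non-sink vertices are  Vtx (m ∸ 1).
  data Vtx : ℕ → Set where
    root : ∀ {k} → Vtx (suc k)
    sub  : ∀ {k} → Fin b → Vtx k → Vtx (suc k)

  Config : ℕ → Set
  Config k = Vtx k → ℤ

  -- value of z at the parent of v (0 if v is the root, whose parent is the sink)
  parentVal : ∀ {k} → Config k → Vtx k → ℤ
  parentVal z root           = + 0
  parentVal z (sub i root)   = z root
  parentVal z (sub i (sub j w)) = parentVal (λ u → z (sub i u)) (sub j w)

  -- sum of z over the non-sink children of v (children that are leaves are the sink)
  childVal : ∀ {k} → Config k → Vtx k → ℤ
  childVal {suc zero}    z root = + 0
  childVal {suc (suc k)} z root = sumFin b (λ i → z (sub i root))
  childVal {suc k}       z (sub i w) = childVal {k} (λ u → z (sub i u)) w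

  -- reduced Laplacian of the wired tree (every non-sink vertex has degree d;
  -- the root has d-1 children and one edge to the sink, other vertices have a
  -- parent and d-1 children; edges to the sink contribute nothing)
  Δ : ∀ {k} → Config k → Config k
  Δ z v = (+ d) * z v - parentVal z v - childVal z v

  _~_ : ∀ {k} → Config k → Config k → Set
  _~_ {k} f g = ∃ λ (z : Config k) → ∀ v → f v - g v ≡ Δ z v

  scaledRoot : ∀ {k} → ℤ → Config k
  scaledRoot c root      = c
  scaledRoot c (sub i v) = + 0

  SP : ℕ → RawGroup 0ℓ 0ℓ
  SP m = record
    { Carrier = Config (m ∸ 1)
    ; _≈_     = _~_
    ; _∙_     = λ f g v → f v + g v
    ; ε       = λ v → + 0
    ; _⁻¹     = λ f v → - f v
    }

  -- R(T̄_m): the cyclic subgroup generated by r̂ (whose class is that of δ_r),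
  -- presented as the image of ℤ → SP(T̄_m), c ↦ c·[δ_r].
  R : ℕ → RawGroup 0ℓ 0ℓ
  R m = record
    { Carrier = ℤ
    ; _≈_     = λ c c' → _~_ {m ∸ 1} (scaledRoot c) (scaledRoot c')
    ; _∙_     = _+_
    ; ε       = + 0
    ; _⁻¹     = -_
    }

  SPpowModDiag : ℕ → RawGroup 0ℓ 0ℓ
  SPpowModDiag m = record
    { Carrier = Fin b → Config (m ∸ 1)
    ; _≈_     = λ x y → ∃ λ (c : ℤ) → ∀ i →
                  _~_ {m ∸ 1} (λ v → x i v - y i v) (scaledRoot c)
    ; _∙_     = λ x y i v → x i v + y i v
    ; ε       = λ i v → + 0
    ; _⁻¹     = λ x i v → - x i v
    }

_⊕_ : RawGroup 0ℓ 0ℓ → RawGroup 0ℓ 0ℓ → RawGroup 0ℓ 0ℓ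
G ⊕ H = record
  { Carrier = G.Carrier × H.Carrier
  ; _≈_     = λ { (a , b) (a' , b') → (a G.≈ a') × (b H.≈ b') }
  ; _∙_     = λ { (a , b) (a' , b') → (a G.∙ a') , (b H.∙ b') }
  ; ε       = G.ε , H.ε
  ; _⁻¹     = λ { (a , b) → (a G.⁻¹) , (b H.⁻¹) }
  }
  where
    module G = RawGroup G
    module H = RawGroup H

_≃_ : RawGroup 0ℓ 0ℓ → RawGroup 0ℓ 0ℓ → Set
G ≃ H = Σ (RawGroup.Carrier G → RawGroup.Carrier H)
          (GroupMorphisms.IsGroupIsomorphism G H)

{-# OPTIONS --safe #-}
-- Let e = d - 1 and M = 1 + e + ⋯ + eⁿ⁻¹. The subtree-size function Λ is harmonic off the
-- root and ΔΛ = M·δᵣ; as Δ is symmetric, ρ = -e⟨Λ, ·⟩ maps Δℤⱽ into Mℤ, while ρ(δᵣ) = 1 - M.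
-- Hence [δᵣ] has order exactly M and ρ retracts SP(T̄ₙ) onto R ≅ ℤ/M. Toppling the root of T̄ₙ
-- sends one chip to the root of every branch, so the branches of a principal configuration
-- are principal up to a common multiple of δᵣ; conversely, if its branches are, a configuration
-- is principal up to a multiple of δᵣ, which ρ then forces to vanish in SP. Therefore
-- x ↦ (ρ x, branches of x) is the isomorphism.
module Submission where

open import Defs
open import Level using (0ℓ)
open import Function using (_∘_; _⇔_; mk⇔; Equivalence)
open import Data.Nat using (ℕ; zero; suc; _≤_; _∸_; s≤s)
open import Data.Integer using (ℤ; +_; _+_; _-_; _*_; -_)
open import Data.Integer.Properties
  using (+-identityʳ; +-inverseʳ; *-zeroʳ; *-identityˡ; *-distribˡ-+; *-distribʳ-+;
         neg-distrib-+; neg-distribʳ-*; +-commutativeSemigroup)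
open import Algebra.Properties.CommutativeSemigroup +-commutativeSemigroup using (interchange)
open import Data.Integer.Divisibility.Signed
  using (_∣_; divides; ∣-refl; ∣n⇒∣m*n; ∣m⇒∣-m; ∣m+n∣n⇒∣m; ∣m∣n⇒∣m-n)
open import Data.Integer.Tactic.RingSolver using (solve-∀)
open import Data.Fin using (Fin)
open import Data.Product using (∃; _×_; _,_; proj₁; proj₂; map₁)
open import Relation.Binary.PropositionalEquality
open import Algebra.Bundles.Raw using (RawGroup)
open import Algebra.Morphism.Structures using (module GroupMorphisms)

m-[m-n]≡n : ∀ m n → m - (m - n) ≡ n
m-[m-n]≡n = solve-∀

m-n+n≡m : ∀ m n → m - n + n ≡ m
m-n+n≡m = solve-∀

[m-n]+[n-o]≡m-o : ∀ m n o → (m - n) + (n - o) ≡ m - o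
[m-n]+[n-o]≡m-o = solve-∀

sumFin-cong : ∀ n {f g : Fin n → ℤ} → f ≗ g → sumFin n f ≡ sumFin n g
sumFin-cong zero    f≗g = refl
sumFin-cong (suc n) f≗g = cong₂ _+_ (f≗g Fin.zero) (sumFin-cong n (f≗g ∘ Fin.suc))

sumFin-+ : ∀ n (f g : Fin n → ℤ) → sumFin n (λ i → f i + g i) ≡ sumFin n f + sumFin n g
sumFin-+ zero    f g = refl
sumFin-+ (suc n) f g =
  trans (cong (_+_ (f Fin.zero + g Fin.zero)) (sumFin-+ n (f ∘ Fin.suc) (g ∘ Fin.suc)))
        (interchange (f Fin.zero) (g Fin.zero) _ _)

sumFin-neg : ∀ n (f : Fin n → ℤ) → sumFin n (λ i → - f i) ≡ - sumFin n f
sumFin-neg zero    f = refl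
sumFin-neg (suc n) f = trans (cong (_+_ (- f Fin.zero)) (sumFin-neg n (f ∘ Fin.suc)))
                             (sym (neg-distrib-+ (f Fin.zero) _))

sumFin-* : ∀ n c (f : Fin n → ℤ) → sumFin n (λ i → c * f i) ≡ c * sumFin n f
sumFin-* zero    c f = sym (*-zeroʳ c)
sumFin-* (suc n) c f = trans (cong (_+_ (c * f Fin.zero)) (sumFin-* n c (f ∘ Fin.suc)))
                             (sym (*-distribˡ-+ c (f Fin.zero) _))

sumFin-const : ∀ n c → sumFin n (λ _ → c) ≡ + n * c
sumFin-const zero    c = refl
sumFin-const (suc n) c = begin
  c + sumFin n (λ _ → c)  ≡⟨ cong₂ _+_ (sym (*-identityˡ c)) (sumFin-const n c) ⟩
  + 1 * c + + n * c       ≡⟨ *-distribʳ-+ c (+ 1) (+ n) ⟨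
  + suc n * c             ∎
  where open ≡-Reasoning

sumFin-zero : ∀ n → sumFin n (λ _ → + 0) ≡ + 0
sumFin-zero zero    = refl
sumFin-zero (suc n) = cong (_+_ (+ 0)) (sumFin-zero n)

module _ (e : ℕ) where

  private
    d : ℕ
    d = suc e

  V : ℕ → Set
  V = Vtx d

  Conf : ℕ → Set
  Conf = Config d

  δᵣ : ∀ {k} → ℤ → Conf k
  δᵣ = scaledRoot d

  infix 4 _≈_
  _≈_ : ∀ {k} → Conf k → Conf k → Set
  _≈_ = _~_ d

  infixl 6 _⊖_
  _⊖_ : ∀ {k} → Conf k → Conf k → Conf k
  (x ⊖ y) v = x v - y v

  branch : ∀ {k} → Fin e → Conf (suc k) → Conf k
  branch i x v = x (sub i v)

  node : ∀ {k} → ℤ → (Fin e → Conf k) → Conf (suc k)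
  node a ys root      = a
  node a ys (sub i v) = ys i v

  δᵣ-zero : ∀ {k} → δᵣ {k} (+ 0) ≗ (λ _ → + 0)
  δᵣ-zero root      = refl
  δᵣ-zero (sub i v) = refl

  δᵣ-* : ∀ {k} q a → (λ v → q * δᵣ a v) ≗ δᵣ {k} (q * a)
  δᵣ-* q a root      = refl
  δᵣ-* q a (sub i v) = *-zeroʳ q

  δᵣ-⊖ : ∀ {k} a b → δᵣ a ⊖ δᵣ b ≗ δᵣ {k} (a - b)
  δᵣ-⊖ a b root      = refl
  δᵣ-⊖ a b (sub i v) = refl

  δᵣ-cancel : ∀ {k} x t (v : V k) → x - δᵣ t v - δᵣ (- t) v ≡ x
  δᵣ-cancel x t root      = cancel x t
    where
    cancel : ∀ x t → x - t - - t ≡ x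
    cancel = solve-∀
  δᵣ-cancel x t (sub i v) = trans (+-identityʳ (x - + 0)) (+-identityʳ x)

  parentVal-+ : ∀ {k} (x y : Conf k) v →
                parentVal d (λ u → x u + y u) v ≡ parentVal d x v + parentVal d y v
  parentVal-+ x y root              = refl
  parentVal-+ x y (sub i root)      = refl
  parentVal-+ x y (sub i (sub j w)) = parentVal-+ (branch i x) (branch i y) (sub j w)

  parentVal-* : ∀ {k} c (x : Conf k) v → parentVal d (λ u → c * x u) v ≡ c * parentVal d x v
  parentVal-* c x root              = sym (*-zeroʳ c)
  parentVal-* c x (sub i root)      = refl
  parentVal-* c x (sub i (sub j w)) = parentVal-* c (branch i x) (sub j w)

  childVal-+ : ∀ {k} (x y : Conf k) v →
               childVal d (λ u → x u + y u) v ≡ childVal d x v + childVal d y v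
  childVal-+ {suc zero}    x y root      = refl
  childVal-+ {suc (suc k)} x y root      = sumFin-+ e (λ i → x (sub i root)) (λ i → y (sub i root))
  childVal-+ {suc (suc k)} x y (sub i w) = childVal-+ (branch i x) (branch i y) w

  childVal-* : ∀ {k} c (x : Conf k) v → childVal d (λ u → c * x u) v ≡ c * childVal d x v
  childVal-* {suc zero}    c x root      = sym (*-zeroʳ c)
  childVal-* {suc (suc k)} c x root      = sumFin-* e c (λ i → x (sub i root))
  childVal-* {suc (suc k)} c x (sub i w) = childVal-* c (branch i x) w

  Δ-+ : ∀ {k} (x y : Conf k) v → Δ d (λ u → x u + y u) v ≡ Δ d x v + Δ d y v
  Δ-+ x y v = trans (cong₂ (λ p q → + d * (x v + y v) - p - q) (parentVal-+ x y v) (childVal-+ x y v))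
                    (linear (+ d) (x v) (y v) _ _ _ _)
    where
    linear : ∀ m a b p q r s → m * (a + b) - (p + q) - (r + s) ≡ (m * a - p - r) + (m * b - q - s)
    linear = solve-∀

  Δ-* : ∀ {k} c (x : Conf k) v → Δ d (λ u → c * x u) v ≡ c * Δ d x v
  Δ-* c x v = trans (cong₂ (λ p q → + d * (c * x v) - p - q) (parentVal-* c x v) (childVal-* c x v))
                    (homogeneous (+ d) c (x v) _ _)
    where
    homogeneous : ∀ m c a p r → m * (c * a) - c * p - c * r ≡ c * (m * a - p - r)
    homogeneous = solve-∀

  -- + 0 * i reduces to + 0, so this is Δ-* at c = + 0.
  Δ-zero : ∀ {k} (v : V k) → Δ d (λ _ → + 0) v ≡ + 0
  Δ-zero = Δ-* (+ 0) (λ _ → + 0)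

  Δ-branch : ∀ {k} (z : Conf (suc k)) i (v : V k) →
             Δ d z (sub i v) ≡ Δ d (branch i z) v - δᵣ (z root) v
  Δ-branch {suc k} z i root      = swap (+ d * z (sub i root)) (z root) (childVal d (branch i z) root)
    where
    swap : ∀ a p c → a - p - c ≡ a - + 0 - c - p
    swap = solve-∀
  Δ-branch {suc k} z i (sub j w) = sym (+-identityʳ _)

  geom : ℕ → ℤ
  geom zero    = + 0
  geom (suc j) = + e * geom j + + 1

  rootOrder : ℕ → ℤ
  rootOrder k = geom (suc (suc k))

  Λ : ∀ {k} → Conf k
  Λ {suc k} root      = geom (suc k)
  Λ         (sub i v) = Λ v

  Δ-Λ : ∀ {k} (v : V (suc k)) → Δ d Λ v ≡ δᵣ (rootOrder k) v
  Δ-Λ {zero}  root      = base (+ e)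
    where
    base : ∀ m → (+ 1 + m) * (m * + 0 + + 1) - + 0 - + 0 ≡ m * (m * + 0 + + 1) + + 1
    base = solve-∀
  Δ-Λ {suc k} root      =
    trans (cong (λ s → + d * rootOrder k - + 0 - s) (sumFin-const e (geom (suc k))))
          (step (+ e) (geom (suc k)))
    where
    step : ∀ m h → (+ 1 + m) * (m * h + + 1) - + 0 - m * h ≡ m * (m * h + + 1) + + 1
    step = solve-∀
  Δ-Λ {suc k} (sub i v) = begin
    Δ d Λ (sub i v)                          ≡⟨ Δ-branch Λ i v ⟩
    Δ d Λ v - δᵣ (rootOrder k) v             ≡⟨ cong (_- δᵣ (rootOrder k) v) (Δ-Λ v) ⟩
    δᵣ (rootOrder k) v - δᵣ (rootOrder k) v  ≡⟨ +-inverseʳ (δᵣ (rootOrder k) v) ⟩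
    + 0                                      ∎
    where open ≡-Reasoning

  ⟨_,_⟩ : ∀ {k} → Conf k → Conf k → ℤ
  ⟨_,_⟩ {zero}  x y = + 0
  ⟨_,_⟩ {suc k} x y = x root * y root + sumFin e (λ i → ⟨ branch i x , branch i y ⟩)

  ⟨⟩-cong : ∀ {k} (x : Conf k) {y y'} → y ≗ y' → ⟨ x , y ⟩ ≡ ⟨ x , y' ⟩
  ⟨⟩-cong {zero}  x y≗y' = refl
  ⟨⟩-cong {suc k} x y≗y' = cong₂ _+_ (cong (x root *_) (y≗y' root))
                                     (sumFin-cong e (λ i → ⟨⟩-cong (branch i x) (y≗y' ∘ sub i)))

  ⟨⟩-+ : ∀ {k} (x y y' : Conf k) → ⟨ x , (λ v → y v + y' v) ⟩ ≡ ⟨ x , y ⟩ + ⟨ x , y' ⟩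
  ⟨⟩-+ {zero}  x y y' = refl
  ⟨⟩-+ {suc k} x y y' = begin
    x root * (y root + y' root) + below (λ v → y v + y' v)
      ≡⟨ cong₂ _+_ (*-distribˡ-+ (x root) (y root) (y' root)) below-+ ⟩
    (x root * y root + x root * y' root) + (below y + below y')
      ≡⟨ interchange (x root * y root) (x root * y' root) (below y) (below y') ⟩
    ⟨ x , y ⟩ + ⟨ x , y' ⟩
      ∎
    where
    open ≡-Reasoning
    below : Conf (suc k) → ℤ
    below z = sumFin e (λ i → ⟨ branch i x , branch i z ⟩)
    below-+ : below (λ v → y v + y' v) ≡ below y + below y'
    below-+ = trans (sumFin-cong e (λ i → ⟨⟩-+ (branch i x) (branch i y) (branch i y')))
                    (sumFin-+ e (λ i → ⟨ branch i x , branch i y ⟩) (λ i → ⟨ branch i x , branch i y' ⟩))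

  ⟨⟩-neg : ∀ {k} (x y : Conf k) → ⟨ x , (λ v → - y v) ⟩ ≡ - ⟨ x , y ⟩
  ⟨⟩-neg {zero}  x y = refl
  ⟨⟩-neg {suc k} x y = begin
    x root * - y root + below (λ v → - y v)
      ≡⟨ cong₂ _+_ (sym (neg-distribʳ-* (x root) (y root))) below-neg ⟩
    - (x root * y root) + - below y
      ≡⟨ neg-distrib-+ (x root * y root) (below y) ⟨
    - ⟨ x , y ⟩
      ∎
    where
    open ≡-Reasoning
    below : Conf (suc k) → ℤ
    below z = sumFin e (λ i → ⟨ branch i x , branch i z ⟩)
    below-neg : below (λ v → - y v) ≡ - below y
    below-neg = trans (sumFin-cong e (λ i → ⟨⟩-neg (branch i x) (branch i y)))
                      (sumFin-neg e (λ i → ⟨ branch i x , branch i y ⟩))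

  ⟨⟩-zero : ∀ {k} (x : Conf k) → ⟨ x , (λ _ → + 0) ⟩ ≡ + 0
  ⟨⟩-zero {zero}  x = refl
  ⟨⟩-zero {suc k} x = cong₂ _+_ (*-zeroʳ (x root))
                                (trans (sumFin-cong e (λ i → ⟨⟩-zero (branch i x))) (sumFin-zero e))

  ⟨⟩-⊖ : ∀ {k} (x y y' : Conf k) → ⟨ x , y ⊖ y' ⟩ ≡ ⟨ x , y ⟩ - ⟨ x , y' ⟩
  ⟨⟩-⊖ x y y' = trans (⟨⟩-+ x y (λ v → - y' v)) (cong (_+_ ⟨ x , y ⟩) (⟨⟩-neg x y'))

  ⟨Λ,δᵣ⟩ : ∀ {k} a → ⟨ Λ , δᵣ {suc k} a ⟩ ≡ geom (suc k) * a
  ⟨Λ,δᵣ⟩ {k} a = trans (cong (_+_ (geom (suc k) * a)) branchesVanish) (+-identityʳ (geom (suc k) * a))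
    where
    branchesVanish : sumFin e (λ _ → ⟨ Λ {k} , (λ _ → + 0) ⟩) ≡ + 0
    branchesVanish = trans (sumFin-cong e (λ _ → ⟨⟩-zero {k} Λ)) (sumFin-zero e)

  ⟨Λ,Δ⟩ : ∀ {k} (z : Conf (suc k)) → ⟨ Λ , Δ d z ⟩ ≡ rootOrder k * z root
  ⟨Λ,Δ⟩ {zero}  z = trans (cong (_+_ (geom 1 * Δ d z root)) (sumFin-zero e)) (base (+ e) (z root))
    where
    base : ∀ m a → (m * + 0 + + 1) * ((+ 1 + m) * a - + 0 - + 0) + + 0 ≡ (m * (m * + 0 + + 1) + + 1) * a
    base = solve-∀
  ⟨Λ,Δ⟩ {suc k} z = begin
    rootOrder k * Δ d z root + sumFin e (λ i → ⟨ Λ , branch i (Δ d z) ⟩)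
      ≡⟨ cong (_+_ (rootOrder k * Δ d z root)) branchSum ⟩
    rootOrder k * Δ d z root + (rootOrder k * childVal d z root + + e * - (geom (suc k) * z root))
      ≡⟨ collect (+ e) (geom (suc k)) (z root) (childVal d z root) ⟩
    rootOrder (suc k) * z root
      ∎
    where
    open ≡-Reasoning
    onBranch : ∀ i → ⟨ Λ , branch i (Δ d z) ⟩ ≡ rootOrder k * z (sub i root) + - (geom (suc k) * z root)
    onBranch i = begin
      ⟨ Λ , branch i (Δ d z) ⟩                                ≡⟨ ⟨⟩-cong Λ (Δ-branch z i) ⟩
      ⟨ Λ , Δ d (branch i z) ⊖ δᵣ (z root) ⟩                   ≡⟨ ⟨⟩-⊖ Λ (Δ d (branch i z)) (δᵣ (z root)) ⟩
      ⟨ Λ , Δ d (branch i z) ⟩ - ⟨ Λ , δᵣ {suc k} (z root) ⟩   ≡⟨ cong₂ _-_ (⟨Λ,Δ⟩ (branch i z))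
                                                                          (⟨Λ,δᵣ⟩ {k} (z root)) ⟩
      rootOrder k * z (sub i root) - geom (suc k) * z root      ∎
    branchSum : sumFin e (λ i → ⟨ Λ , branch i (Δ d z) ⟩)
                ≡ rootOrder k * childVal d z root + + e * - (geom (suc k) * z root)
    branchSum = begin
      sumFin e (λ i → ⟨ Λ , branch i (Δ d z) ⟩)
        ≡⟨ sumFin-cong e onBranch ⟩
      sumFin e (λ i → rootOrder k * z (sub i root) + - (geom (suc k) * z root))
        ≡⟨ sumFin-+ e (λ i → rootOrder k * z (sub i root)) (λ _ → - (geom (suc k) * z root)) ⟩
      sumFin e (λ i → rootOrder k * z (sub i root)) + sumFin e (λ _ → - (geom (suc k) * z root))
        ≡⟨ cong₂ _+_ (sumFin-* e (rootOrder k) (λ i → z (sub i root)))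
                     (sumFin-const e (- (geom (suc k) * z root))) ⟩
      rootOrder k * childVal d z root + + e * - (geom (suc k) * z root)
        ∎
    collect : ∀ m h a s → (m * h + + 1) * ((+ 1 + m) * a - + 0 - s) + ((m * h + + 1) * s + m * - (h * a))
                          ≡ (m * (m * h + + 1) + + 1) * a
    collect = solve-∀

  ρ : ∀ {k} → Conf k → ℤ
  ρ x = - (+ e) * ⟨ Λ , x ⟩

  ρ-cong : ∀ {k} {x y : Conf k} → x ≗ y → ρ x ≡ ρ y
  ρ-cong x≗y = cong (- (+ e) *_) (⟨⟩-cong Λ x≗y)

  ρ-+ : ∀ {k} (x y : Conf k) → ρ (λ v → x v + y v) ≡ ρ x + ρ y
  ρ-+ x y = trans (cong (- (+ e) *_) (⟨⟩-+ Λ x y)) (*-distribˡ-+ (- (+ e)) ⟨ Λ , x ⟩ ⟨ Λ , y ⟩)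

  ρ-neg : ∀ {k} (x : Conf k) → ρ (λ v → - x v) ≡ - ρ x
  ρ-neg x = trans (cong (- (+ e) *_) (⟨⟩-neg Λ x)) (sym (neg-distribʳ-* (- (+ e)) ⟨ Λ , x ⟩))

  ρ-zero : ∀ {k} → ρ {k} (λ _ → + 0) ≡ + 0
  ρ-zero {k} = trans (cong (- (+ e) *_) (⟨⟩-zero {k} Λ)) (*-zeroʳ (- (+ e)))

  ρ-⊖ : ∀ {k} (x y : Conf k) → ρ (x ⊖ y) ≡ ρ x - ρ y
  ρ-⊖ x y = trans (ρ-+ x (λ v → - y v)) (cong (_+_ (ρ x)) (ρ-neg y))

  ρ-δᵣ : ∀ {k} a → ρ (δᵣ {suc k} a) ≡ a - a * rootOrder k
  ρ-δᵣ {k} a = trans (cong (- (+ e) *_) (⟨Λ,δᵣ⟩ {k} a)) (unit (+ e) (geom (suc k)) a)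
    where
    unit : ∀ m h a → - m * (h * a) ≡ a - a * (m * h + + 1)
    unit = solve-∀

  ρ-Δ : ∀ {k} (z : Conf (suc k)) → ρ (Δ d z) ≡ (- (+ e) * z root) * rootOrder k
  ρ-Δ {k} z = trans (cong (- (+ e) *_) (⟨Λ,Δ⟩ z)) (reorder (- (+ e)) (rootOrder k) (z root))
    where
    reorder : ∀ m M a → m * (M * a) ≡ (m * a) * M
    reorder = solve-∀

  -- x ≈ y unfolds to Principal (x ⊖ y).
  Principal : ∀ {k} → Conf k → Set
  Principal {k} w = ∃ λ (z : Conf k) → w ≗ Δ d z

  principal-resp : ∀ {k} {w w' : Conf k} → w ≗ w' → Principal w → Principal w'
  principal-resp w≗w' (z , w≗Δz) = z , λ v → trans (sym (w≗w' v)) (w≗Δz v)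

  principal-zero : ∀ {k} → Principal {k} (λ _ → + 0)
  principal-zero = (λ _ → + 0) , λ v → sym (Δ-zero v)

  principal-+ : ∀ {k} {w w' : Conf k} → Principal w → Principal w' → Principal (λ v → w v + w' v)
  principal-+ (z , w≗Δz) (z' , w'≗Δz') =
    (λ v → z v + z' v) , λ v → trans (cong₂ _+_ (w≗Δz v) (w'≗Δz' v)) (sym (Δ-+ z z' v))

  principal-ρ : ∀ {k} {w : Conf (suc k)} → Principal w → rootOrder k ∣ ρ w
  principal-ρ (z , w≗Δz) = divides (- (+ e) * z root) (trans (ρ-cong w≗Δz) (ρ-Δ z))

  ∣ρ-δᵣ⇒∣ : ∀ {k} {a} → rootOrder k ∣ ρ (δᵣ {suc k} a) → rootOrder k ∣ a
  ∣ρ-δᵣ⇒∣ {k} {a} M∣ρδᵣa =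
    ∣m+n∣n⇒∣m (subst (rootOrder k ∣_) (ρ-δᵣ {k} a) M∣ρδᵣa) (∣m⇒∣-m (∣n⇒∣m*n a ∣-refl))

  principal-δᵣ : ∀ {k} {a} → Principal (δᵣ {suc k} a) ⇔ rootOrder k ∣ a
  principal-δᵣ {k} {a} = mk⇔ (∣ρ-δᵣ⇒∣ {k} ∘ principal-ρ) multiple
    where
    multiple : rootOrder k ∣ a → Principal (δᵣ a)
    multiple (divides q a≡qM) = (λ v → q * Λ v) , λ v → begin
      δᵣ a v                 ≡⟨ cong (λ s → δᵣ s v) a≡qM ⟩
      δᵣ (q * rootOrder k) v ≡⟨ δᵣ-* q (rootOrder k) v ⟨
      q * δᵣ (rootOrder k) v ≡⟨ cong (q *_) (Δ-Λ v) ⟨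
      q * Δ d Λ v            ≡⟨ Δ-* q Λ v ⟨
      Δ d (λ u → q * Λ u) v  ∎
      where open ≡-Reasoning

  principal-branches : ∀ {k} {w : Conf (suc k)} → Principal w →
                       ∃ λ c → ∀ i → Principal (branch i w ⊖ δᵣ c)
  principal-branches {w = w} (z , w≗Δz) = - z root , λ i → branch i z , λ v → begin
    w (sub i v) - δᵣ (- z root) v
      ≡⟨ cong (_- δᵣ (- z root) v) (trans (w≗Δz (sub i v)) (Δ-branch z i v)) ⟩
    Δ d (branch i z) v - δᵣ (z root) v - δᵣ (- z root) v
      ≡⟨ δᵣ-cancel (Δ d (branch i z) v) (z root) v ⟩
    Δ d (branch i z) v
      ∎
    where open ≡-Reasoning

  branches-principal : ∀ {k} {w : Conf (suc k)} {c} → (∀ i → Principal (branch i w ⊖ δᵣ c)) →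
                       ∃ λ a → Principal (w ⊖ δᵣ a)
  branches-principal {k} {w} {c} principalBranch = w root - Δ d Z root , Z , onVertex
    where
    Z : Conf (suc k)
    Z = node (- c) (proj₁ ∘ principalBranch)
    onVertex : w ⊖ δᵣ (w root - Δ d Z root) ≗ Δ d Z
    onVertex root      = m-[m-n]≡n (w root) (Δ d Z root)
    onVertex (sub i v) = begin
      w (sub i v) - + 0                  ≡⟨ +-identityʳ (w (sub i v)) ⟩
      w (sub i v)                        ≡⟨ δᵣ-cancel (w (sub i v)) c v ⟨
      w (sub i v) - δᵣ c v - δᵣ (- c) v  ≡⟨ cong (_- δᵣ (- c) v) (proj₂ (principalBranch i) v) ⟩
      Δ d (branch i Z) v - δᵣ (- c) v    ≡⟨ Δ-branch Z i v ⟨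
      Δ d Z (sub i v)                    ∎
      where open ≡-Reasoning

  principal⇔ρ×branches : ∀ {k} {w : Conf (suc k)} →
    Principal w ⇔ (rootOrder k ∣ ρ w × ∃ λ c → ∀ i → Principal (branch i w ⊖ δᵣ c))
  principal⇔ρ×branches {k} {w} = mk⇔ (λ p → principal-ρ p , principal-branches p) fromParts
    where
    fromParts : rootOrder k ∣ ρ w × (∃ λ c → ∀ i → Principal (branch i w ⊖ δᵣ c)) → Principal w
    fromParts (M∣ρw , _ , principalBranch) =
      principal-resp (λ v → m-n+n≡m (w v) (δᵣ a v))
                     (principal-+ w⊖δᵣa (Equivalence.from (principal-δᵣ {k}) (∣ρ-δᵣ⇒∣ {k} M∣ρδᵣa)))
      where
      a : ℤ
      a = proj₁ (branches-principal {w = w} principalBranch)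
      w⊖δᵣa : Principal (w ⊖ δᵣ a)
      w⊖δᵣa = proj₂ (branches-principal {w = w} principalBranch)
      M∣ρδᵣa : rootOrder k ∣ ρ (δᵣ {suc k} a)
      M∣ρδᵣa = subst (rootOrder k ∣_) (m-[m-n]≡n (ρ w) (ρ (δᵣ {suc k} a)))
                     (∣m∣n⇒∣m-n M∣ρw (subst (rootOrder k ∣_) (ρ-⊖ w (δᵣ a)) (principal-ρ w⊖δᵣa)))

  ≈-reflexive : ∀ {k} {x y : Conf k} → x ≗ y → x ≈ y
  ≈-reflexive {x = x} x≗y =
    principal-resp (λ v → sym (trans (cong (_-_ (x v)) (sym (x≗y v))) (+-inverseʳ (x v)))) principal-zero

  ≈-trans : ∀ {k} {x y z : Conf k} → x ≈ y → y ≈ z → x ≈ z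
  ≈-trans {x = x} {y} {z} x≈y y≈z =
    principal-resp (λ v → [m-n]+[n-o]≡m-o (x v) (y v) (z v)) (principal-+ x≈y y≈z)

  δᵣ-≈ : ∀ {k} {a b} → δᵣ {suc k} a ≈ δᵣ b ⇔ rootOrder k ∣ a - b
  δᵣ-≈ {a = a} {b} = mk⇔ (Equivalence.to principal-δᵣ ∘ principal-resp (δᵣ-⊖ a b))
                         (principal-resp (sym ∘ δᵣ-⊖ a b) ∘ Equivalence.from principal-δᵣ)

  Target : ℕ → RawGroup 0ℓ 0ℓ
  Target k = R d (suc (suc k)) ⊕ SPpowModDiag d (suc k)

  root≡⇒Target-≈ : ∀ {k} {a b} (X : Fin e → Conf k) → a ≡ b → RawGroup._≈_ (Target k) (a , X) (b , X)
  root≡⇒Target-≈ {a = a} X refl =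
    ≈-reflexive {x = δᵣ a} (λ _ → refl) ,
    + 0 , λ i → ≈-reflexive (λ v → trans (+-inverseʳ (X i v)) (sym (δᵣ-zero v)))

  decompose : ∀ {k} → Conf (suc k) → ℤ × (Fin e → Conf k)
  decompose x = ρ x , λ i → branch i x

  decompose-≈ : ∀ {k} (x y : Conf (suc k)) →
                x ≈ y ⇔ RawGroup._≈_ (Target k) (decompose x) (decompose y)
  decompose-≈ {k} x y = mk⇔
    (map₁ (from rootPart ∘ subst (rootOrder k ∣_) (ρ-⊖ x y)) ∘ to characterisation)
    (from characterisation ∘ map₁ (subst (rootOrder k ∣_) (sym (ρ-⊖ x y)) ∘ to rootPart))
    where
    characterisation : Principal (x ⊖ y) ⇔
                       (rootOrder k ∣ ρ (x ⊖ y) × ∃ λ c → ∀ i → Principal (branch i (x ⊖ y) ⊖ δᵣ c))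
    characterisation = principal⇔ρ×branches
    rootPart : δᵣ (ρ x) ≈ δᵣ (ρ y) ⇔ rootOrder k ∣ ρ x - ρ y
    rootPart = δᵣ-≈
    open Equivalence

  -- ρ (δᵣ a) ≡ a modulo rootOrder k, so the shift by e * S cancels the branches' contribution to ρ.
  decompose-surjective : ∀ {k} (p : ℤ × (Fin e → Conf k)) →
                         ∃ λ x → ∀ {z} → z ≈ x → RawGroup._≈_ (Target k) (decompose z) p
  decompose-surjective {k} (c , ys) = x , λ {z} z≈x →
    map₁ (λ ρz≈ρx → ≈-trans {x = δᵣ (ρ z)} ρz≈ρx (Equivalence.from (δᵣ-≈ {k}) M∣ρx-c))
         (Equivalence.to (decompose-≈ z x) z≈x)
    where
    S : ℤ
    S = sumFin e (λ i → ⟨ Λ , ys i ⟩)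
    x : Conf (suc k)
    x = node (c + + e * S) ys
    M∣ρx-c : rootOrder k ∣ ρ x - c
    M∣ρx-c = divides (- (c + + e * S)) (identity (+ e) (geom (suc k)) c S)
      where
      identity : ∀ m h c S → - m * (h * (c + m * S) + S) - c ≡ - (c + m * S) * (m * h + + 1)
      identity = solve-∀

  decompose-isGroupIsomorphism : ∀ {k} →
    GroupMorphisms.IsGroupIsomorphism (SP d (suc (suc k))) (Target k) decompose
  decompose-isGroupIsomorphism {k} = record
    { isGroupMonomorphism = record
      { isGroupHomomorphism = record
        { isMonoidHomomorphism = record
          { isMagmaHomomorphism = record
            { isRelHomomorphism = record { cong = λ {x} {y} → Equivalence.to (decompose-≈ x y) }
            ; homo = λ x y → root≡⇒Target-≈ (λ i → branch i (λ v → x v + y v)) (ρ-+ x y)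
            }
          ; ε-homo = root≡⇒Target-≈ (λ _ _ → + 0) (ρ-zero {suc k})
          }
        ; ⁻¹-homo = λ x → root≡⇒Target-≈ (λ i v → - x (sub i v)) (ρ-neg x)
        }
      ; injective = λ {x} {y} → Equivalence.from (decompose-≈ x y)
      }
    ; surjective = decompose-surjective
    }

  SP≃R⊕SPpowModDiag : ∀ k → SP d (suc (suc k)) ≃ (R d (suc (suc k)) ⊕ SPpowModDiag d (suc k))
  SP≃R⊕SPpowModDiag k = decompose , decompose-isGroupIsomorphism

proposition4p3 : (d n : ℕ) → 3 ≤ d → 3 ≤ n →
    SP d n ≃ (R d n ⊕ SPpowModDiag d (n ∸ 1))
proposition4p3 d n (s≤s (s≤s (s≤s _))) (s≤s (s≤s (s≤s _))) = SP≃R⊕SPpowModDiag (d ∸ 1) (n ∸ 2)
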